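{- Let $\lambda$ be a nonnesting set partition of $[n]$ and $(S,\sigma)\in\mathscr T_\lambda(q)$. Then $\dim\mathfrak D_{S,\sigma}=|\uparrow^1\lambda|-|\mathrm{rows}(S)|$ and $\dim\mathfrak Z_{S,\sigma}=|\uparrow^1\lambda|+|\mathrm{cols}(S)|$.
   Context: $q$ a prime power; $\mathfrak{ut}_n(\mathbb F_q)$ strictly upper triangular matrices, $e_{i,j}$ matrix units; dimensions over $\mathbb F_q$. $[[n]]=\{(i,j):1\le i<j\le n\}$; $(i,j)\preceq(r,s)$ iff $r\le i<j\le s$. A set partition of $[n]$ is $\lambda\subseteq[[n]]$ with no two distinct elements sharing a first or sharing a second coordinate; nonnesting if a $\preceq$-antichain. $\uparrow^{\ell}\lambda=\{(r,s):\exists(i,j)\in\lambda,\ r\le i<j\le s,\ s-r\ge j-i+\ell\}$, $\uparrow\lambda=\uparrow^0\lambda$. $\mathfrak{ut}_{\mathcal F}=\bigoplus_{(i,j)\in\mathcal F}\mathbb F_qe_{i,j}$, $\mathfrak{ut}_\lambda=\mathfrak{ut}_{\uparrow\lambda}$. For disjoint set partitions $\lambda,\nu$, $S=\lambda\sqcup\nu$ is a splice of $\lambda$ if (S1) for every $(i,k)\in\nu$ there is $j$, $i<j<k$, with $(i,j)\in\lambda$ or $(j,k)\in\lambda$; (S2) for all $1\le j<k\le n$: there is $i$ with $(i,j)\in\lambda,(i,k)\in\nu$ iff there is $l$ with $(k,l)\in\lambda,(j,l)\in\nu$. $\mathrm{bind}(S)=\{(i,j,k,l):(i,j),(k,l)\in\lambda,(i,k),(j,l)\in\nu,j<k\}$.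 Columns: classes of $\lambda$ under the equivalence generated by $(i,j)\sim(k,l)$ for bindings; rows: classes of $\nu$ under the equivalence generated by $(i,k)\sim(j,l)$ for bindings $(i,j,k,l)$. $S$ is tight if $S\cap\uparrow^2\lambda=\emptyset$. $\mathscr T_\lambda(q)$: pairs $(S,\sigma)$ with $S$ a tight splice of $\lambda$ and $\sigma:\mathrm{bind}(S)\to\mathbb F_q^\times$. $\mathfrak Z_{S,\sigma}=\{a\in\mathfrak{ut}_\lambda:a_{i,j}=\sigma(i,j,j+1,l)a_{j+1,l}\ \forall(i,j,j+1,l)\in\mathrm{bind}(S)\}$; $\mathfrak D_{S,\sigma}=\mathfrak{ut}_{\uparrow\lambda\setminus S}\oplus\bigoplus_{(i,j,j+1,l)\in\mathrm{bind}(S)}\mathbb F_q(e_{i,j+1}-\sigma(i,j,j+1,l)e_{j,l})$. -}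

module Defs where

open import Level using (0ℓ)
open import Algebra.Bundles using (CommutativeRing)
open import Data.Bool using (if_then_else_; _∧_)
open import Data.Nat using (ℕ; zero; suc; _+_; _∸_; _≤_; _<_; _^_; _≟_)
open import Data.Nat.Primality using (Prime)
open import Data.Product using (Σ; ∃; ∃-syntax; _×_; _,_; proj₁; proj₂)
open import Data.Sum using (_⊎_)
open import Data.List using (List; []; _∷_; length; _++_)
open import Data.List.Membership.Propositional using (_∈_)
open import Data.List.Relation.Unary.All using (All)
open import Data.List.Relation.Unary.Any using (Any)
open import Data.List.Relation.Unary.AllPairs using (AllPairs)
open import Data.List.Relation.Unary.Unique.Propositional using (Unique)
open import Data.Fin using (Fin)
open import Function.Bundles using (_⇔_)
open import Relation.Nullary using (¬_)
open import Relation.Nullary.Decidable using (⌊_⌋)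
open import Relation.Binary.PropositionalEquality using (_≡_)
open import Relation.Binary.Construct.Closure.Equivalence using (EqClosure)

Arc : Set
Arc = ℕ × ℕ

InBox : ℕ → Arc → Set
InBox n (r , s) = 1 ≤ r × r < s × s ≤ n

-- a finite set of arcs is represented by a list (membership = _∈_)
IsSetPartition : ℕ → List Arc → Set
IsSetPartition n λ' =
  (∀ {a} → a ∈ λ' → InBox n a) ×
  (∀ {a b} → a ∈ λ' → b ∈ λ' → proj₁ a ≡ proj₁ b → a ≡ b) ×
  (∀ {a b} → a ∈ λ' → b ∈ λ' → proj₂ a ≡ proj₂ b → a ≡ b)

_⪯_ : Arc → Arc → Set
(i , j) ⪯ (r , s) = r ≤ i × i < j × j ≤ s

Nonnesting : List Arc → Set
Nonnesting λ' = ∀ {a b} → a ∈ λ' → b ∈ λ' → a ⪯ b → a ≡ b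

Up : ℕ → ℕ → List Arc → Arc → Set
Up ℓ n λ' (r , s) = InBox n (r , s) ×
  (∃[ i ] ∃[ j ] ((i , j) ∈ λ' × r ≤ i × i < j × j ≤ s × (j ∸ i) + ℓ ≤ s ∸ r))

HasCard : (Arc → Set) → ℕ → Set
HasCard P k = Σ (List Arc) λ L → Unique L × (∀ x → (x ∈ L ⇔ P x)) × length L ≡ k

Disjoint : List Arc → List Arc → Set
Disjoint λ' ν = ∀ {a} → a ∈ λ' → ¬ (a ∈ ν)

S1 : List Arc → List Arc → Set
S1 λ' ν = ∀ {i k} → (i , k) ∈ ν →
  ∃[ j ] (i < j × j < k × ((i , j) ∈ λ' ⊎ (j , k) ∈ λ'))

S2 : ℕ → List Arc → List Arc → Set
S2 n λ' ν = ∀ j k → 1 ≤ j → j < k → k ≤ n →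
  ((∃[ i ] ((i , j) ∈ λ' × (i , k) ∈ ν)) ⇔ (∃[ l ] ((k , l) ∈ λ' × (j , l) ∈ ν)))

-- S = λ ⊔ ν is a splice of λ (λ, ν disjoint set partitions of [n])
IsSplice : ℕ → List Arc → List Arc → Set
IsSplice n λ' ν = IsSetPartition n λ' × IsSetPartition n ν × Disjoint λ' ν × S1 λ' ν × S2 n λ' ν

IsBinding : List Arc → List Arc → ℕ → ℕ → ℕ → ℕ → Set
IsBinding λ' ν i j k l = (i , j) ∈ λ' × (k , l) ∈ λ' × (i , k) ∈ ν × (j , l) ∈ ν × j < k

Tight : ℕ → List Arc → List Arc → Set
Tight n λ' ν = ∀ {a} → a ∈ (λ' ++ ν) → ¬ Up 2 n λ' a

ColGen : List Arc → List Arc → Arc → Arc → Set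
ColGen λ' ν a b = ∃[ i ] ∃[ j ] ∃[ k ] ∃[ l ]
  (IsBinding λ' ν i j k l × a ≡ (i , j) × b ≡ (k , l))

RowGen : List Arc → List Arc → Arc → Arc → Set
RowGen λ' ν a b = ∃[ i ] ∃[ j ] ∃[ k ] ∃[ l ]
  (IsBinding λ' ν i j k l × a ≡ (i , k) × b ≡ (j , l))

-- the elements of A fall into exactly k classes of the equivalence
-- relation generated by R: f maps A onto Fin k with fibres = classes
NumClasses : List Arc → (Arc → Arc → Set) → ℕ → Set
NumClasses A R k = Σ (Arc → Fin k) λ f →
  (∀ {x y} → x ∈ A → y ∈ A → (f x ≡ f y ⇔ EqClosure R x y)) ×
  (∀ c → ∃[ x ] (x ∈ A × f x ≡ c))

module _ (R : CommutativeRing 0ℓ 0ℓ) where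
  open CommutativeRing R renaming (_+_ to _+F_; _*_ to _*F_)

  IsField : Set
  IsField = ¬ (1# ≈ 0#) × (∀ x → ¬ (x ≈ 0#) → ∃[ y ] (x *F y ≈ 1#))

  HasOrder : ℕ → Set
  HasOrder q = (∃[ p ] ∃[ m ] (Prime p × 1 ≤ m × q ≡ p ^ m)) ×
    (Σ (List Carrier) λ L → length L ≡ q × (∀ x → Any (x ≈_) L) ×
       AllPairs (λ a b → ¬ (a ≈ b)) L)

  -- matrices: (r , s)-entries; only entries in [[n]] will be nonzero
  Mat : Set
  Mat = ℕ → ℕ → Carrier

  _≈M_ : Mat → Mat → Set
  a ≈M b = ∀ r s → a r s ≈ b r s

  0M : Mat
  0M r s = 0#

  _+M_ : Mat → Mat → Mat
  (a +M b) r s = a r s +F b r s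

  _·M_ : Carrier → Mat → Mat
  (c ·M a) r s = c *F a r s

  unit : ℕ → ℕ → Mat
  unit i j r s = if ⌊ r ≟ i ⌋ ∧ ⌊ s ≟ j ⌋ then 1# else 0#

  lincomb : List Carrier → List Mat → Mat
  lincomb (c ∷ cs) (v ∷ vs) = (c ·M v) +M lincomb cs vs
  lincomb _ _ = 0M

  LinIndep : List Mat → Set
  LinIndep B = ∀ cs → length cs ≡ length B → lincomb cs B ≈M 0M → All (_≈ 0#) cs

  Spans : (Mat → Set) → List Mat → Set
  Spans W B = ∀ a → W a → ∃[ cs ] (length cs ≡ length B × a ≈M lincomb cs B)

  IsDim : (Mat → Set) → ℕ → Set
  IsDim W d = Σ (List Mat) λ B →
    length B ≡ d × All W B × LinIndep B × Spans W B

  -- σ : bind(S) → F^×  (given as a function on all quadruples,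
  -- only its values on bindings matter)
  Weight : Set
  Weight = ℕ → ℕ → ℕ → ℕ → Carrier

  IsUnitWeight : List Arc → List Arc → Weight → Set
  IsUnitWeight λ' ν σ = ∀ i j k l → IsBinding λ' ν i j k l → ¬ (σ i j k l ≈ 0#)

  Zsp : ℕ → List Arc → List Arc → Weight → Mat → Set
  Zsp n λ' ν σ a =
    (∀ r s → ¬ Up 0 n λ' (r , s) → a r s ≈ 0#) ×
    (∀ i j l → IsBinding λ' ν i j (suc j) l → a i j ≈ σ i j (suc j) l *F a (suc j) l)

  gen : Weight → ℕ × ℕ × ℕ × Carrier → Mat
  gen σ (i , j , l , c) = c ·M (unit i (suc j) +M ((- σ i j (suc j) l) ·M unit j l))

  sumGen : Weight → List (ℕ × ℕ × ℕ × Carrier) → Mat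
  sumGen σ [] = 0M
  sumGen σ (g ∷ gs) = gen σ g +M sumGen σ gs

  -- 𝔇_{S,σ} = ut_{↑λ ∖ S} ⊕ span{ e_{i,j+1} - σ(i,j,j+1,l) e_{j,l} }
  Dsp : ℕ → List Arc → List Arc → Weight → Mat → Set
  Dsp n λ' ν σ a = ∃[ b ] Σ (List (ℕ × ℕ × ℕ × Carrier)) λ L →
    (∀ r s → ¬ (Up 0 n λ' (r , s) × ¬ ((r , s) ∈ (λ' ++ ν))) → b r s ≈ 0#) ×
    All (λ { (i , j , l , c) → IsBinding λ' ν i j (suc j) l }) L ×
    (a ≈M (b +M sumGen σ L))

module Submission where

-- Since λ is nonnesting, ↑λ is the disjoint union of λ and ↑¹λ; condition (S1) puts ν inside ↑¹λ,
-- and tightness forces every binding to have the shape (i , j , j+1 , l). Bindings therefore give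
-- functional successor relations on λ (the columns) and on ν (the rows), both increasing the first
-- coordinate, so each column and each row is a chain ending in a unique terminal arc.
--
-- 𝔷 has the basis consisting of e_x for x ∈ ↑¹λ and, for each column, the matrix carrying along the
-- chain the products of σ down to its end; each is 1 at a position where all others vanish.
-- 𝔇 has the basis indexed by the arcs x ∈ ↑¹λ that do not end a row: e_x when x ∉ ν, and
-- e_x − σ e_y when the binding continues the row from x to y. It is unitriangular with respect to
-- the first coordinate, and since every row has exactly one end, it has |↑¹λ| − |rows(S)| elements.

open import Defs
open import Level using (0ℓ)
open import Algebra.Bundles using (CommutativeRing)
open import Data.Nat using (ℕ; zero; suc; _+_; _∸_; _≤_; _<_; _≟_; _≤?_; _⊓_; z≤n; s≤s⁻¹)
open import Data.Nat.Properties
  using (≤-refl; ≤-reflexive; ≤-trans; <-trans; <⇒≤; <-≤-trans; <-irrefl; +-comm; +-suc; +-∸-comm;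
         +-monoʳ-≤; ∸-monoˡ-≤; ∸-monoˡ-<; ∸-monoʳ-<; m+n∸m≡n; m≤m+n; m+1+n≰m; m≤n⇒m<n∨m≡n;
         suc-injective; ⊓-idem)
import Data.Nat.Properties as ℕ
open import Data.Fin using (Fin)
import Data.Fin as Fin
open import Data.Product using (∃; ∃-syntax; _×_; _,_; proj₁; proj₂)
open import Data.Product.Properties using (≡-dec)
open import Data.Sum using (_⊎_; inj₁; inj₂; [_,_]′)
open import Data.Sum.Properties using (inj₁-injective; inj₂-injective) renaming (≡-dec to ⊎-≡-dec)
open import Data.List using (List; []; _∷_; length; map; _++_; replicate; zipWith; filter; allFin)
open import Data.List.Properties
  using (length-map; length-replicate; length-zipWith; length-tabulate; length-++)
open import Data.List.Membership.Propositional using (_∈_; find; lose)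
open import Data.List.Membership.Propositional.Properties
  using (∈-map⁺; ∈-map⁻; ∈-++⁺ˡ; ∈-++⁺ʳ; ∈-++⁻; ∈-filter⁺; ∈-filter⁻; ∈-allFin)
open import Data.List.Membership.Propositional.Properties.WithK using (unique∧set⇒bag)
open import Data.List.Relation.Binary.BagAndSetEquality using (∼bag⇒↭)
open import Data.List.Relation.Binary.Permutation.Propositional.Properties using (↭-length)
open import Data.List.Relation.Unary.Any using (here; there; any?)
open import Data.List.Relation.Unary.All using (All; []; _∷_)
import Data.List.Relation.Unary.All as All
import Data.List.Relation.Unary.All.Properties as All
open import Data.List.Relation.Unary.AllPairs using ([]; _∷_)
open import Data.List.Relation.Unary.Unique.Propositional using (Unique)
import Data.List.Relation.Unary.Unique.Propositional.Properties as Unique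
open import Function using (_∘_)
open import Function.Bundles using (_⇔_; mk⇔; Equivalence)
open import Relation.Nullary using (¬_; Dec; yes; no; contradiction; contraposition; ¬?)
open import Relation.Nullary.Decidable using (_×-dec_; map′)
open import Relation.Binary.Definitions using (DecidableEquality)
open import Relation.Binary.PropositionalEquality
  using (_≡_; _≢_; refl; sym; trans; cong; cong₂; subst)
open import Relation.Binary.Construct.Closure.Equivalence using (EqClosure)
open import Relation.Binary.Construct.Closure.ReflexiveTransitive using (ε; _◅_)
open import Relation.Binary.Construct.Closure.Symmetric using (fwd; bwd)

arcLength : Arc → ℕ
arcLength (i , j) = j ∸ i

<⇒+1≤ : ∀ {m n} → m < n → m + 1 ≤ n
<⇒+1≤ {m} {n} m<n = subst (_≤ n) (+-comm 1 m) m<n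

⪯-strict-length : ∀ {a b} → a ⪯ b → a ≢ b → arcLength a < arcLength b
⪯-strict-length {i , j} {r , s} (r≤i , i<j , j≤s) a≢b
  with m≤n⇒m<n∨m≡n r≤i | m≤n⇒m<n∨m≡n j≤s
... | inj₁ r<i  | _         = <-≤-trans (∸-monoʳ-< r<i (<⇒≤ i<j)) (∸-monoˡ-≤ r j≤s)
... | inj₂ refl | inj₁ j<s  = ∸-monoˡ-< j<s (<⇒≤ i<j)
... | inj₂ refl | inj₂ refl = contradiction refl a≢b

∸-widen : ∀ {i j k} d → i ≤ j → j + d ≤ k → (j ∸ i) + d ≤ k ∸ i
∸-widen {i} {k = k} d i≤j j+d≤k = subst (_≤ k ∸ i) (+-∸-comm d i≤j) (∸-monoˡ-≤ i j+d≤k)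

length-unique-≡ : {A : Set} {xs ys : List A} → Unique xs → Unique ys →
  (∀ {x} → x ∈ xs ⇔ x ∈ ys) → length xs ≡ length ys
length-unique-≡ xs! ys! xs≈ys = ↭-length (∼bag⇒↭ (unique∧set⇒bag xs! ys! xs≈ys))

length-filter-∁ : {A : Set} {P : A → Set} (P? : ∀ x → Dec (P x)) (xs : List A) →
  length (filter P? xs) + length (filter (¬? ∘ P?) xs) ≡ length xs
length-filter-∁ P? [] = refl
length-filter-∁ P? (x ∷ xs) with P? x
... | yes _ = cong suc (length-filter-∁ P? xs)
... | no _  = trans (+-suc _ _) (cong suc (length-filter-∁ P? xs))

module _ {I B : Set} (_≟I_ : DecidableEquality I) (default : B) where

  indexedBy : List B → List I → I → B
  indexedBy (v ∷ vs) (p ∷ P) q with p ≟I q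
  ... | yes _ = v
  ... | no _  = indexedBy vs P q
  indexedBy _ _ _ = default

  map-indexedBy : ∀ vs {P} → Unique P → length vs ≡ length P → map (indexedBy vs P) P ≡ vs
  map-indexedBy [] {[]} _ _ = refl
  map-indexedBy (v ∷ vs) {p ∷ P} (p∉P ∷ P!) len =
    cong₂ _∷_ head (trans (skip P p∉P) (map-indexedBy vs P! (suc-injective len)))
    where
    head : indexedBy (v ∷ vs) (p ∷ P) p ≡ v
    head with p ≟I p
    ... | yes _  = refl
    ... | no p≢p = contradiction refl p≢p
    skip : ∀ qs → All (p ≢_) qs → map (indexedBy (v ∷ vs) (p ∷ P)) qs ≡ map (indexedBy vs P) qs
    skip [] [] = refl
    skip (q ∷ qs) (p≢q ∷ ps) with p ≟I q
    ... | yes p≡q = contradiction p≡q p≢q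
    ... | no _    = cong (_ ∷_) (skip qs ps)

-- Linear algebra of matrices over a commutative ring

_≟Arc_ : DecidableEquality Arc
_≟Arc_ = ≡-dec _≟_ _≟_

open import Data.List.Membership.DecPropositional _≟Arc_ using (_∈?_)

module LinearAlgebra (F : CommutativeRing 0ℓ 0ℓ) where

  open CommutativeRing F
    renaming (_+_ to _+F_; _*_ to _*F_; refl to ≈-refl; sym to ≈-sym; trans to ≈-trans)
  open import Relation.Binary.Reasoning.Setoid setoid
  open import Algebra.Properties.CommutativeSemigroup +-commutativeSemigroup using (interchange)

  infix 4 _≋_
  _≋_ : Mat F → Mat F → Set
  _≋_ = _≈M_ F

  entry : Mat F → Arc → Carrier
  entry a (r , s) = a r s

  unitAt : Arc → Mat F
  unitAt (i , j) = unit F i j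

  unitAt-diagonal : ∀ p → entry (unitAt p) p ≈ 1#
  unitAt-diagonal (i , j) with i ≟ i | j ≟ j
  ... | yes _  | yes _  = ≈-refl
  ... | no i≢i | _      = contradiction refl i≢i
  ... | yes _  | no j≢j = contradiction refl j≢j

  unitAt-offDiagonal : ∀ {p x} → x ≢ p → entry (unitAt p) x ≈ 0#
  unitAt-offDiagonal {i , j} {r , s} x≢p with r ≟ i | s ≟ j
  ... | yes refl | yes refl = contradiction refl x≢p
  ... | yes _    | no _     = ≈-refl
  ... | no _     | yes _    = ≈-refl
  ... | no _     | no _     = ≈-refl

  *-vanishʳ : ∀ {c b} → b ≈ 0# → c *F b ≈ 0#
  *-vanishʳ b≈0 = ≈-trans (*-cong ≈-refl b≈0) (zeroʳ _)

  *-vanishˡ : ∀ {c b} → c ≈ 0# → c *F b ≈ 0#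
  *-vanishˡ c≈0 = ≈-trans (*-cong c≈0 ≈-refl) (zeroˡ _)

  module _ {I : Set} (g : I → Carrier) (b : I → Mat F) where

    combination : List I → Mat F
    combination P = lincomb F (map g P) (map b P)

    combination-vanishing : ∀ P {x} → (∀ {q} → q ∈ P → g q *F entry (b q) x ≈ 0#) →
      entry (combination P) x ≈ 0#
    combination-vanishing [] _ = ≈-refl
    combination-vanishing (p ∷ P) terms≈0 =
      ≈-trans (+-cong (terms≈0 (here refl)) (combination-vanishing P (terms≈0 ∘ there)))
              (+-identityˡ 0#)

    combination-single : ∀ {P p x} → Unique P → p ∈ P →
      (∀ {q} → q ∈ P → q ≢ p → g q *F entry (b q) x ≈ 0#) →
      entry (combination P) x ≈ g p *F entry (b p) x
    combination-single {q ∷ P} (q∉P ∷ _) (here refl) others≈0 =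
      ≈-trans (+-cong ≈-refl (combination-vanishing P λ q′∈P →
                                others≈0 (there q′∈P) (All.lookup q∉P q′∈P ∘ sym)))
              (+-identityʳ _)
    combination-single {q ∷ P} (q∉P ∷ P!) (there p∈P) others≈0 =
      ≈-trans (+-cong (others≈0 (here refl) (All.lookup q∉P p∈P))
                      (combination-single P! p∈P (others≈0 ∘ there)))
              (+-identityˡ _)

  -- The coefficients vanish by induction on the height: at the pivot of p, every other
  -- term has a vanishing vector or a coefficient already known to vanish.
  unitriangular⇒independent : {I : Set} → DecidableEquality I →
    (b : I → Mat F) (pivot : I → Arc) (height : I → ℕ) {P : List I} → Unique P →
    (∀ {p} → p ∈ P → entry (b p) (pivot p) ≈ 1#) →
    (∀ {p q} → p ∈ P → q ∈ P → q ≢ p → entry (b q) (pivot p) ≈ 0# ⊎ height q < height p) →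
    LinIndep F (map b P)
  unitriangular⇒independent {I} _≟I_ b pivot height {P} P! diagonal lower cs len cs·b≈0 =
    subst (All (_≈ 0#)) g≡cs (All.map⁺ (All.tabulate (coefficient≈0 _ ≤-refl)))
    where
    g : I → Carrier
    g = indexedBy _≟I_ 0# cs P
    g≡cs : map g P ≡ cs
    g≡cs = map-indexedBy _≟I_ 0# cs P! (trans len (length-map b P))
    g·b≈0 : ∀ x → entry (combination g b P) x ≈ 0#
    g·b≈0 (r , s) = subst (λ cs → lincomb F cs (map b P) r s ≈ 0#) (sym g≡cs) (cs·b≈0 r s)
    coefficient≈0 : ∀ m {p} → height p < m → p ∈ P → g p ≈ 0#
    coefficient≈0 (suc m) {p} h<m p∈P = begin
      g p                                  ≈⟨ *-identityʳ _ ⟨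
      g p *F 1#                            ≈⟨ *-cong ≈-refl (diagonal p∈P) ⟨
      g p *F entry (b p) (pivot p)         ≈⟨ combination-single g b P! p∈P others≈0 ⟨
      entry (combination g b P) (pivot p)  ≈⟨ g·b≈0 (pivot p) ⟩
      0#                                   ∎
      where
      others≈0 : ∀ {q} → q ∈ P → q ≢ p → g q *F entry (b q) (pivot p) ≈ 0#
      others≈0 q∈P q≢p with lower p∈P q∈P q≢p
      ... | inj₁ b≈0   = *-vanishʳ b≈0
      ... | inj₂ below = *-vanishˡ (coefficient≈0 m (<-≤-trans below (s≤s⁻¹ h<m)) q∈P)

  biorthogonal⇒independent : {I : Set} → DecidableEquality I →
    (b : I → Mat F) (pivot : I → Arc) {P : List I} → Unique P →
    (∀ {p} → p ∈ P → entry (b p) (pivot p) ≈ 1#) →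
    (∀ {p q} → p ∈ P → q ∈ P → q ≢ p → entry (b q) (pivot p) ≈ 0#) →
    LinIndep F (map b P)
  biorthogonal⇒independent _≟I_ b pivot P! diagonal offDiagonal =
    unitriangular⇒independent _≟I_ b pivot (λ _ → 0) P! diagonal
      (λ p∈P q∈P q≢p → inj₁ (offDiagonal p∈P q∈P q≢p))

  InSpan : List (Mat F) → Mat F → Set
  InSpan B a = ∃[ cs ] (length cs ≡ length B × a ≋ lincomb F cs B)

  module _ {B : List (Mat F)} where

    span-resp-≋ : ∀ {a a′} → a ≋ a′ → InSpan B a′ → InSpan B a
    span-resp-≋ a≋a′ (cs , len , a′≋) = cs , len , λ r s → ≈-trans (a≋a′ r s) (a′≋ r s)

    span-0 : InSpan B (0M F)
    span-0 = replicate (length B) 0# , length-replicate _ , λ r s → ≈-sym (zeros B r s)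
      where
      zeros : ∀ B r s → lincomb F (replicate (length B) 0#) B r s ≈ 0#
      zeros [] r s = ≈-refl
      zeros (b ∷ B) r s = ≈-trans (+-cong (zeroˡ _) (zeros B r s)) (+-identityˡ 0#)

    span-+ : ∀ {a a′} → InSpan B a → InSpan B a′ → InSpan B (_+M_ F a a′)
    span-+ (cs , len , a≋) (cs′ , len′ , a′≋) =
      zipWith _+F_ cs cs′ , length-sum ,
      λ r s → ≈-trans (+-cong (a≋ r s) (a′≋ r s)) (≈-sym (sum cs cs′ B len len′ r s))
      where
      length-sum : length (zipWith _+F_ cs cs′) ≡ length B
      length-sum = trans (length-zipWith _+F_ cs cs′) (trans (cong₂ _⊓_ len len′) (⊓-idem _))
      sum : ∀ cs cs′ B → length cs ≡ length B → length cs′ ≡ length B → ∀ r s →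
        lincomb F (zipWith _+F_ cs cs′) B r s ≈ lincomb F cs B r s +F lincomb F cs′ B r s
      sum [] [] [] _ _ r s = ≈-sym (+-identityˡ 0#)
      sum (c ∷ cs) (c′ ∷ cs′) (b ∷ B) len len′ r s = begin
        (c +F c′) *F b r s +F lincomb F (zipWith _+F_ cs cs′) B r s
          ≈⟨ +-cong (distribʳ _ c c′) (sum cs cs′ B (suc-injective len) (suc-injective len′) r s) ⟩
        (c *F b r s +F c′ *F b r s) +F (lincomb F cs B r s +F lincomb F cs′ B r s)
          ≈⟨ interchange _ _ _ _ ⟩
        (c *F b r s +F lincomb F cs B r s) +F (c′ *F b r s +F lincomb F cs′ B r s) ∎

    span-· : ∀ {a} c → InSpan B a → InSpan B (_·M_ F c a)
    span-· c (cs , len , a≋) =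
      map (c *F_) cs , trans (length-map _ cs) len ,
      λ r s → ≈-trans (*-cong ≈-refl (a≋ r s)) (≈-sym (scale cs B r s))
      where
      scale : ∀ cs B r s → lincomb F (map (c *F_) cs) B r s ≈ c *F lincomb F cs B r s
      scale [] B r s = ≈-sym (zeroʳ c)
      scale (d ∷ cs) [] r s = ≈-sym (zeroʳ c)
      scale (d ∷ cs) (b ∷ B) r s = begin
        (c *F d) *F b r s +F lincomb F (map (c *F_) cs) B r s ≈⟨ +-cong (*-assoc c d _) (scale cs B r s) ⟩
        c *F (d *F b r s) +F c *F lincomb F cs B r s          ≈⟨ distribˡ c _ _ ⟨
        c *F (d *F b r s +F lincomb F cs B r s)               ∎

  span-∈ : ∀ {B v} → v ∈ B → InSpan B v
  span-∈ {b ∷ B} (here refl) with span-0 {B}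
  ... | cs , len , 0≋ =
    1# ∷ cs , cong suc len ,
    λ r s → ≈-sym (≈-trans (+-cong (*-identityˡ _) (≈-sym (0≋ r s))) (+-identityʳ _))
  span-∈ {b ∷ B} (there v∈B) with span-∈ v∈B
  ... | cs , len , v≋ =
    0# ∷ cs , cong suc len ,
    λ r s → ≈-trans (v≋ r s) (≈-sym (≈-trans (+-cong (zeroˡ _) ≈-refl) (+-identityˡ _)))

  span-lincomb : ∀ {B} V → (∀ {v} → v ∈ V → InSpan B v) → ∀ cs → InSpan B (lincomb F cs V)
  span-lincomb _ _ [] = span-0
  span-lincomb [] _ (c ∷ cs) = span-0
  span-lincomb (v ∷ V) V⊆B (c ∷ cs) =
    span-+ (span-· c (V⊆B (here refl))) (span-lincomb V (V⊆B ∘ there) cs)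

  expand-supported : ∀ {a U} → Unique U → (∀ {x} → ¬ x ∈ U → entry a x ≈ 0#) →
    a ≋ combination (entry a) unitAt U
  expand-supported {a} {U} U! outside≈0 r s with (r , s) ∈? U
  ... | yes x∈U = begin
    a r s                                ≈⟨ *-identityʳ _ ⟨
    a r s *F 1#                          ≈⟨ *-cong ≈-refl (unitAt-diagonal (r , s)) ⟨
    a r s *F unit F r s r s              ≈⟨ combination-single (entry a) unitAt U! x∈U others≈0 ⟨
    combination (entry a) unitAt U r s   ∎
    where
    others≈0 : ∀ {q} → q ∈ U → q ≢ (r , s) → entry a q *F entry (unitAt q) (r , s) ≈ 0#
    others≈0 _ q≢x = *-vanishʳ (unitAt-offDiagonal (q≢x ∘ sym))
  ... | no x∉U = ≈-trans (outside≈0 x∉U) (≈-sym (combination-vanishing (entry a) unitAt U terms≈0))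
    where
    terms≈0 : ∀ {q} → q ∈ U → entry a q *F entry (unitAt q) (r , s) ≈ 0#
    terms≈0 {q} q∈U = *-vanishʳ (unitAt-offDiagonal {q} {r , s} λ { refl → x∉U q∈U })

-- Chains of a functional relation increasing a bounded height

module Chains {X : Set} (A : List X) (R : X → X → Set) (R? : ∀ x y → Dec (R x y))
  (R-functional : ∀ {x y z} → R x y → R x z → y ≡ z)
  (R-closed : ∀ {x y} → R x y → y ∈ A)
  (height : X → ℕ) (bound : ℕ)
  (height-bounded : ∀ {x} → x ∈ A → height x < bound)
  (R-ascending : ∀ {x y} → R x y → height x < height y) where

  Terminal : X → Set
  Terminal x = ¬ ∃ (R x)

  successor? : ∀ x → Dec (∃ (R x))
  successor? x = map′ (λ r → let (y , _ , rxy) = find r in y , rxy)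
                      (λ (y , rxy) → lose (R-closed rxy) rxy)
                      (any? (R? x) A)

  infix 4 _↝_
  data _↝_ : X → X → Set where
    done : ∀ {x} → Terminal x → x ↝ x
    step : ∀ {x y e} → R x y → y ↝ e → x ↝ e

  ↝-total : ∀ {x} → x ∈ A → ∃ (x ↝_)
  ↝-total {x} x∈A = climb bound x∈A (m≤m+n bound (height x))
    where
    climb : ∀ fuel {x} → x ∈ A → bound ≤ fuel + height x → ∃ (x ↝_)
    climb zero x∈A bound≤h = contradiction (<-≤-trans (height-bounded x∈A) bound≤h) (<-irrefl refl)
    climb (suc fuel) {x} x∈A bound≤ with successor? x
    ... | no terminal = x , done terminal
    ... | yes (y , rxy) = let (e , y↝e) = climb fuel (R-closed rxy) bound≤′ in e , step rxy y↝e
      where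
      bound≤′ : bound ≤ fuel + height y
      bound≤′ = ≤-trans bound≤ (subst (_≤ fuel + height y) (+-suc fuel (height x))
                                       (+-monoʳ-≤ fuel (R-ascending rxy)))

  ↝-functional : ∀ {x e e′} → x ↝ e → x ↝ e′ → e ≡ e′
  ↝-functional (done _) (done _) = refl
  ↝-functional (done terminal) (step rxy _) = contradiction (_ , rxy) terminal
  ↝-functional (step rxy _) (done terminal) = contradiction (_ , rxy) terminal
  ↝-functional (step rxy y↝e) (step rxy′ y′↝e′) with R-functional rxy rxy′
  ... | refl = ↝-functional y↝e y′↝e′

  ↝-terminal : ∀ {x e} → x ↝ e → Terminal e
  ↝-terminal (done terminal) = terminal
  ↝-terminal (step _ y↝e) = ↝-terminal y↝e

  ↝-∈ : ∀ {x e} → x ∈ A → x ↝ e → e ∈ A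
  ↝-∈ x∈A (done _) = x∈A
  ↝-∈ _ (step rxy y↝e) = ↝-∈ (R-closed rxy) y↝e

  ↝⇒EqClosure : ∀ {x e} → x ↝ e → EqClosure R x e
  ↝⇒EqClosure (done _) = ε
  ↝⇒EqClosure (step rxy y↝e) = fwd rxy ◅ ↝⇒EqClosure y↝e

  ↝-successor : ∀ {x y e} → R x y → x ↝ e → y ↝ e
  ↝-successor rxy (done terminal) = contradiction (_ , rxy) terminal
  ↝-successor rxy (step rxy′ y′↝e) with R-functional rxy rxy′
  ... | refl = y′↝e

  EqClosure-↝ : ∀ {x y e} → EqClosure R x y → x ↝ e → y ↝ e
  EqClosure-↝ ε x↝e = x↝e
  EqClosure-↝ (fwd rxz ◅ z~y) x↝e = EqClosure-↝ z~y (↝-successor rxz x↝e)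
  EqClosure-↝ (bwd rzx ◅ z~y) x↝e = EqClosure-↝ z~y (step rzx x↝e)

  module Classes {k : ℕ} (f : X → Fin k)
    (f-classes : ∀ {x y} → x ∈ A → y ∈ A → (f x ≡ f y ⇔ EqClosure R x y))
    (f-onto : ∀ c → ∃[ x ] (x ∈ A × f x ≡ c)) where

    private
      representative : Fin k → X
      representative c = proj₁ (f-onto c)

      representative-∈ : ∀ c → representative c ∈ A
      representative-∈ c = proj₁ (proj₂ (f-onto c))

    classEnd : Fin k → X
    classEnd c = proj₁ (↝-total (representative-∈ c))

    representative↝classEnd : ∀ c → representative c ↝ classEnd c
    representative↝classEnd c = proj₂ (↝-total (representative-∈ c))

    classEnd-∈ : ∀ c → classEnd c ∈ A
    classEnd-∈ c = ↝-∈ (representative-∈ c) (representative↝classEnd c)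

    classEnd-terminal : ∀ c → Terminal (classEnd c)
    classEnd-terminal c = ↝-terminal (representative↝classEnd c)

    f-classEnd : ∀ c → f (classEnd c) ≡ c
    f-classEnd c =
      trans (sym (Equivalence.from (f-classes (representative-∈ c) (classEnd-∈ c))
                                   (↝⇒EqClosure (representative↝classEnd c))))
            (proj₂ (proj₂ (f-onto c)))

    ↝-classEnd : ∀ {x} → x ∈ A → x ↝ classEnd (f x)
    ↝-classEnd {x} x∈A = EqClosure-↝ representative~x (representative↝classEnd (f x))
      where
      representative~x : EqClosure R (representative (f x)) x
      representative~x =
        Equivalence.to (f-classes (representative-∈ (f x)) x∈A) (proj₂ (proj₂ (f-onto (f x))))

    terminal⇒classEnd : ∀ {x} → x ∈ A → Terminal x → x ≡ classEnd (f x)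
    terminal⇒classEnd x∈A terminal = ↝-functional (done terminal) (↝-classEnd x∈A)

    terminals-count : ∀ {E} → Unique E → (∀ {x} → x ∈ E ⇔ (x ∈ A × Terminal x)) → length E ≡ k
    terminals-count {E} E! ∈E =
      trans (length-unique-≡ E! (Unique.map⁺ classEnd-injective (Unique.allFin⁺ k)) (mk⇔ to from))
            (trans (length-map classEnd (allFin k)) (length-tabulate _))
      where
      classEnd-injective : ∀ {c c′} → classEnd c ≡ classEnd c′ → c ≡ c′
      classEnd-injective {c} {c′} e = trans (sym (f-classEnd c)) (trans (cong f e) (f-classEnd c′))
      to : ∀ {x} → x ∈ E → x ∈ map classEnd (allFin k)
      to {x} x∈E with Equivalence.to ∈E x∈E
      ... | x∈A , terminal = subst (_∈ map classEnd (allFin k)) (sym (terminal⇒classEnd x∈A terminal))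
                                   (∈-map⁺ classEnd (∈-allFin (f x)))
      from : ∀ {x} → x ∈ map classEnd (allFin k) → x ∈ E
      from x∈ with ∈-map⁻ classEnd x∈
      ... | c , _ , refl = Equivalence.from ∈E (classEnd-∈ c , classEnd-terminal c)

-- Geometry of a tight splice of a nonnesting set partition

module Splice {n : ℕ} {λ' ν : List Arc} (splice : IsSplice n λ' ν)
  (nonnesting : Nonnesting λ') (tight : Tight n λ' ν) where

  private
    λ-partition : IsSetPartition n λ'
    λ-partition = proj₁ splice

    ν-partition : IsSetPartition n ν
    ν-partition = proj₁ (proj₂ splice)

    s1 : S1 λ' ν
    s1 = proj₁ (proj₂ (proj₂ (proj₂ splice)))

  λ-box : ∀ {x} → x ∈ λ' → InBox n x
  λ-box = proj₁ λ-partition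

  ν-box : ∀ {x} → x ∈ ν → InBox n x
  ν-box = proj₁ ν-partition

  λ-ordered : ∀ {i j} → (i , j) ∈ λ' → i < j
  λ-ordered = proj₁ ∘ proj₂ ∘ λ-box

  λ-functional : ∀ {i j j′} → (i , j) ∈ λ' → (i , j′) ∈ λ' → j ≡ j′
  λ-functional ij ij′ = cong proj₂ (proj₁ (proj₂ λ-partition) ij ij′ refl)

  ν-functional : ∀ {i k k′} → (i , k) ∈ ν → (i , k′) ∈ ν → k ≡ k′
  ν-functional ik ik′ = cong proj₂ (proj₁ (proj₂ ν-partition) ik ik′ refl)

  first<n : ∀ {x} → InBox n x → proj₁ x < n
  first<n (_ , i<j , j≤n) = <-≤-trans i<j j≤n

  binding-adjacent : ∀ {i j k l} → IsBinding λ' ν i j k l → k ≡ suc j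
  binding-adjacent {i} {j} {k} (ij , _ , ik , _ , j<k) with m≤n⇒m<n∨m≡n j<k
  ... | inj₂ k≡1+j = sym k≡1+j
  ... | inj₁ 1+j<k = contradiction (ν-box ik , i , j , ij , ≤-refl , λ-ordered ij , <⇒≤ j<k , gap)
                                   (tight (∈-++⁺ʳ λ' ik))
    where
    gap : (j ∸ i) + 2 ≤ k ∸ i
    gap = ∸-widen 2 (<⇒≤ (λ-ordered ij)) (subst (_≤ k) (+-comm 2 j) 1+j<k)

  λ⊆↑ : ∀ {x} → x ∈ λ' → Up 0 n λ' x
  λ⊆↑ {r , s} x∈λ =
    λ-box x∈λ , r , s , x∈λ , ≤-refl , λ-ordered x∈λ , ≤-refl , ≤-reflexive (ℕ.+-identityʳ _)

  ↑¹-disjoint-λ : ∀ {x} → Up 1 n λ' x → ¬ x ∈ λ'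
  ↑¹-disjoint-λ {r , s} (_ , i , j , ij , r≤i , i<j , j≤s , longer) x∈λ
    with nonnesting ij x∈λ (r≤i , i<j , j≤s)
  ... | refl = m+1+n≰m (s ∸ r) longer

  ↑¹⊆↑ : ∀ {x} → Up 1 n λ' x → Up 0 n λ' x
  ↑¹⊆↑ (box , i , j , ij , r≤i , i<j , j≤s , longer) =
    box , i , j , ij , r≤i , i<j , j≤s , ≤-trans (+-monoʳ-≤ (j ∸ i) z≤n) longer

  properly-above⇒↑¹ : ∀ {a x} → InBox n x → a ∈ λ' → a ⪯ x → a ≢ x → Up 1 n λ' x
  properly-above⇒↑¹ {i , j} box ij a⪯x@(r≤i , i<j , j≤s) a≢x =
    box , i , j , ij , r≤i , i<j , j≤s , <⇒+1≤ (⪯-strict-length a⪯x a≢x)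

  ↑-λ⊆↑¹ : ∀ {x} → Up 0 n λ' x → ¬ x ∈ λ' → Up 1 n λ' x
  ↑-λ⊆↑¹ (box , i , j , ij , r≤i , i<j , j≤s , _) x∉λ =
    properly-above⇒↑¹ box ij (r≤i , i<j , j≤s) λ { refl → x∉λ ij }

  ν⊆↑¹ : ∀ {x} → x ∈ ν → Up 1 n λ' x
  ν⊆↑¹ {i , k} ik with s1 ik
  ... | j , i<j , j<k , inj₁ ij =
    properly-above⇒↑¹ (ν-box ik) ij (≤-refl , i<j , <⇒≤ j<k) λ { refl → <-irrefl refl j<k }
  ... | j , i<j , j<k , inj₂ jk =
    properly-above⇒↑¹ (ν-box ik) jk (<⇒≤ i<j , j<k , ≤-refl) λ { refl → <-irrefl refl i<j }

  Row : Arc → Arc → Set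
  Row = RowGen λ' ν

  Col : Arc → Arc → Set
  Col = ColGen λ' ν

  binding? : ∀ i j k l → Dec (IsBinding λ' ν i j k l)
  binding? i j k l =
    ((i , j) ∈? λ') ×-dec ((k , l) ∈? λ') ×-dec ((i , k) ∈? ν) ×-dec ((j , l) ∈? ν) ×-dec (suc j ≤? k)

  Row? : ∀ x y → Dec (Row x y)
  Row? (i , k) (j , l) = map′ (λ b → i , j , k , l , b , refl , refl)
                              (λ { (_ , _ , _ , _ , b , refl , refl) → b })
                              (binding? i j k l)

  Col? : ∀ x y → Dec (Col x y)
  Col? (i , j) (k , l) = map′ (λ b → i , j , k , l , b , refl , refl)
                              (λ { (_ , _ , _ , _ , b , refl , refl) → b })
                              (binding? i j k l)

  Row-functional : ∀ {x y y′} → Row x y → Row x y′ → y ≡ y′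
  Row-functional (_ , _ , _ , _ , (ij , kl , _) , refl , refl)
                 (_ , _ , _ , _ , (ij′ , kl′ , _) , refl , refl)
    with λ-functional ij ij′
  ... | refl with λ-functional kl kl′
  ...   | refl = refl

  Col-functional : ∀ {x y y′} → Col x y → Col x y′ → y ≡ y′
  Col-functional (_ , _ , _ , _ , (_ , kl , ik , _) , refl , refl)
                 (_ , _ , _ , _ , (_ , kl′ , ik′ , _) , refl , refl)
    with ν-functional ik ik′
  ... | refl with λ-functional kl kl′
  ...   | refl = refl

  Row-source : ∀ {x y} → Row x y → x ∈ ν
  Row-source (_ , _ , _ , _ , (_ , _ , ik , _) , refl , refl) = ik

  Row-target : ∀ {x y} → Row x y → y ∈ ν
  Row-target (_ , _ , _ , _ , (_ , _ , _ , jl , _) , refl , refl) = jl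

  Row-ascending : ∀ {x y} → Row x y → proj₁ x < proj₁ y
  Row-ascending (_ , _ , _ , _ , (ij , _) , refl , refl) = λ-ordered ij

  Col-target : ∀ {x y} → Col x y → y ∈ λ'
  Col-target (_ , _ , _ , _ , (_ , kl , _) , refl , refl) = kl

  Col-ascending : ∀ {x y} → Col x y → proj₁ x < proj₁ y
  Col-ascending (_ , _ , _ , _ , (ij , _ , _ , _ , j<k) , refl , refl) = <-trans (λ-ordered ij) j<k

  module Rows = Chains ν Row Row? Row-functional Row-target proj₁ n (first<n ∘ ν-box) Row-ascending
  module Cols = Chains λ' Col Col? Col-functional Col-target proj₁ n (first<n ∘ λ-box) Col-ascending

-- Bases of 𝔷 and 𝔇

module Dimensions (F : CommutativeRing 0ℓ 0ℓ) {n : ℕ} {λ' ν : List Arc} (splice : IsSplice n λ' ν)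
  (nonnesting : Nonnesting λ') (tight : Tight n λ' ν) (σ : Weight F)
  {up¹ : List Arc} (up¹! : Unique up¹) (∈up¹ : ∀ x → x ∈ up¹ ⇔ Up 1 n λ' x) where

  open CommutativeRing F
    renaming (_+_ to _+F_; _*_ to _*F_; refl to ≈-refl; sym to ≈-sym; trans to ≈-trans)
  open import Relation.Binary.Reasoning.Setoid setoid
  open LinearAlgebra F
  open Splice splice nonnesting tight

  up¹⁺ : ∀ {x} → Up 1 n λ' x → x ∈ up¹
  up¹⁺ = Equivalence.from (∈up¹ _)

  up¹⁻ : ∀ {x} → x ∈ up¹ → Up 1 n λ' x
  up¹⁻ = Equivalence.to (∈up¹ _)

  up¹-disjoint-λ : ∀ {x} → x ∈ up¹ → ¬ x ∈ λ'
  up¹-disjoint-λ = ↑¹-disjoint-λ ∘ up¹⁻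

  module ZspBasis {kc : ℕ} (cols : NumClasses λ' Col kc) where

    open Cols
    private
      fc : Arc → Fin kc
      fc = proj₁ cols

      fc-classes : ∀ {x y} → x ∈ λ' → y ∈ λ' → (fc x ≡ fc y ⇔ EqClosure Col x y)
      fc-classes = proj₁ (proj₂ cols)
    open Classes fc fc-classes (proj₂ (proj₂ cols))

    colWeight : Arc → Arc → Carrier
    colWeight (i , j) (k , l) = σ i j k l

    weight : ∀ {x e} → x ↝ e → Carrier
    weight (done _) = 1#
    weight (step {x} {y} _ y↝e) = colWeight x y *F weight y↝e

    weight-irrelevant : ∀ {x e e′} (ρ : x ↝ e) (ρ′ : x ↝ e′) → weight ρ ≈ weight ρ′
    weight-irrelevant (done _) (done _) = ≈-refl
    weight-irrelevant (done terminal) (step col _) = contradiction (_ , col) terminal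
    weight-irrelevant (step col _) (done terminal) = contradiction (_ , col) terminal
    weight-irrelevant (step col ρ) (step col′ ρ′) with Col-functional col col′
    ... | refl = *-cong ≈-refl (weight-irrelevant ρ ρ′)

    Z-along-↝ : ∀ {a x e} → Zsp F n λ' ν σ a → (ρ : x ↝ e) → entry a x ≈ weight ρ *F entry a e
    Z-along-↝ _ (done _) = ≈-sym (*-identityˡ _)
    Z-along-↝ {a} a∈Z (step (i , j , _ , l , b , refl , refl) ρ) with binding-adjacent b
    ... | refl = begin
      a i j                                ≈⟨ proj₂ a∈Z i j l b ⟩
      σ i j (suc j) l *F a (suc j) l       ≈⟨ *-cong ≈-refl (Z-along-↝ a∈Z ρ) ⟩
      σ i j (suc j) l *F (weight ρ *F _)   ≈⟨ *-assoc _ _ _ ⟨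
      (σ i j (suc j) l *F weight ρ) *F _   ∎

    classEntry : Fin kc → Arc → Carrier
    classEntry c x with x ∈? λ' | fc x Fin.≟ c
    ... | yes x∈λ | yes _ = weight (↝-classEnd x∈λ)
    ... | _       | _     = 0#

    classVector : Fin kc → Mat F
    classVector c r s = classEntry c (r , s)

    classEntry-inClass : ∀ {c x e} → x ∈ λ' → fc x ≡ c → (ρ : x ↝ e) → classEntry c x ≈ weight ρ
    classEntry-inClass {c} {x} x∈λ fx≡c ρ with x ∈? λ' | fc x Fin.≟ c
    ... | yes x∈λ′ | yes _   = weight-irrelevant (↝-classEnd x∈λ′) ρ
    ... | no x∉λ   | _       = contradiction x∈λ x∉λ
    ... | yes _    | no fx≢c = contradiction fx≡c fx≢c

    classEntry-otherClass : ∀ {c x} → fc x ≢ c → classEntry c x ≈ 0#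
    classEntry-otherClass {c} {x} fx≢c with x ∈? λ' | fc x Fin.≟ c
    ... | yes _ | yes fx≡c = contradiction fx≡c fx≢c
    ... | yes _ | no _     = ≈-refl
    ... | no _  | _        = ≈-refl

    classEntry-outside : ∀ {c x} → ¬ x ∈ λ' → classEntry c x ≈ 0#
    classEntry-outside {c} {x} x∉λ with x ∈? λ'
    ... | yes x∈λ = contradiction x∈λ x∉λ
    ... | no _    = ≈-refl

    classVector-Z : ∀ c → Zsp F n λ' ν σ (classVector c)
    classVector-Z c = (λ r s → classEntry-outside ∘ contraposition λ⊆↑) , along-binding
      where
      along-binding : ∀ i j l → IsBinding λ' ν i j (suc j) l →
        classEntry c (i , j) ≈ σ i j (suc j) l *F classEntry c (suc j , l)
      along-binding i j l b@(ij , kl , _) = by-class (fc (i , j) Fin.≟ c)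
        where
        col : Col (i , j) (suc j , l)
        col = i , j , suc j , l , b , refl , refl
        same-class : fc (i , j) ≡ fc (suc j , l)
        same-class = Equivalence.from (fc-classes ij kl) (fwd col ◅ ε)
        by-class : Dec (fc (i , j) ≡ c) →
          classEntry c (i , j) ≈ σ i j (suc j) l *F classEntry c (suc j , l)
        by-class (yes fx≡c) = begin
          classEntry c (i , j)                         ≈⟨ classEntry-inClass ij fx≡c (step col ρ) ⟩
          σ i j (suc j) l *F weight ρ                  ≈⟨ *-cong ≈-refl (classEntry-inClass kl fy≡c ρ) ⟨
          σ i j (suc j) l *F classEntry c (suc j , l)  ∎
          where
          ρ : (suc j , l) ↝ classEnd (fc (suc j , l))
          ρ = ↝-classEnd kl
          fy≡c : fc (suc j , l) ≡ c
          fy≡c = trans (sym same-class) fx≡c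
        by-class (no fx≢c) = begin
          classEntry c (i , j)                         ≈⟨ classEntry-otherClass fx≢c ⟩
          0#                                           ≈⟨ *-vanishʳ (classEntry-otherClass fy≢c) ⟨
          σ i j (suc j) l *F classEntry c (suc j , l)  ∎
          where
          fy≢c : fc (suc j , l) ≢ c
          fy≢c = fx≢c ∘ trans same-class

    unitAt-Z : ∀ {x} → x ∈ up¹ → Zsp F n λ' ν σ (unitAt x)
    unitAt-Z {x} x∈up¹ = outside-↑ , λ i j l (ij , kl , _) →
      ≈-trans (off-λ ij) (≈-sym (*-vanishʳ (off-λ kl)))
      where
      off-λ : ∀ {y} → y ∈ λ' → entry (unitAt x) y ≈ 0#
      off-λ {y} y∈λ = unitAt-offDiagonal {x} {y} λ { refl → up¹-disjoint-λ x∈up¹ y∈λ }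
      outside-↑ : ∀ r s → ¬ Up 0 n λ' (r , s) → entry (unitAt x) (r , s) ≈ 0#
      outside-↑ r s ∉↑ = unitAt-offDiagonal {x} {r , s} λ { refl → ∉↑ (↑¹⊆↑ (up¹⁻ x∈up¹)) }

    Index : Set
    Index = Arc ⊎ Fin kc

    _≟Index_ : DecidableEquality Index
    _≟Index_ = ⊎-≡-dec _≟Arc_ Fin._≟_

    indices : List Index
    indices = map inj₁ up¹ ++ map inj₂ (allFin kc)

    vector : Index → Mat F
    vector (inj₁ x) = unitAt x
    vector (inj₂ c) = classVector c

    pivot : Index → Arc
    pivot (inj₁ x) = x
    pivot (inj₂ c) = classEnd c

    indices! : Unique indices
    indices! =
      Unique.++⁺ (Unique.map⁺ inj₁-injective up¹!) (Unique.map⁺ inj₂-injective (Unique.allFin⁺ kc))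
                 disjoint
      where
      disjoint : ∀ {q} → ¬ (q ∈ map inj₁ up¹ × q ∈ map inj₂ (allFin kc))
      disjoint (q∈₁ , q∈₂) with ∈-map⁻ inj₁ q∈₁ | ∈-map⁻ inj₂ q∈₂
      ... | _ , _ , refl | _ , _ , ()

    length-indices : length indices ≡ length up¹ + kc
    length-indices =
      trans (length-++ (map inj₁ up¹))
            (cong₂ _+_ (length-map inj₁ up¹) (trans (length-map inj₂ (allFin kc)) (length-tabulate _)))

    inj₁∈indices⁻ : ∀ {x} → inj₁ x ∈ indices → x ∈ up¹
    inj₁∈indices⁻ q∈ with ∈-++⁻ (map inj₁ up¹) q∈
    ... | inj₁ q∈₁ with ∈-map⁻ inj₁ q∈₁
    ...   | _ , x∈up¹ , refl = x∈up¹
    inj₁∈indices⁻ _ | inj₂ q∈₂ with ∈-map⁻ inj₂ q∈₂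
    ...   | _ , _ , ()

    vanishes-at-↑¹ : ∀ {x q} → x ∈ up¹ → q ∈ indices → q ≢ inj₁ x → entry (vector q) x ≈ 0#
    vanishes-at-↑¹ {q = inj₁ y} _ _ q≢x = unitAt-offDiagonal (q≢x ∘ cong inj₁ ∘ sym)
    vanishes-at-↑¹ {q = inj₂ c} x∈up¹ _ _ = classEntry-outside (up¹-disjoint-λ x∈up¹)

    vanishes-at-λ : ∀ {x q} → x ∈ λ' → q ∈ indices → q ≢ inj₂ (fc x) → entry (vector q) x ≈ 0#
    vanishes-at-λ {x} {inj₁ y} x∈λ q∈ _ =
      unitAt-offDiagonal {y} {x} λ { refl → up¹-disjoint-λ (inj₁∈indices⁻ q∈) x∈λ }
    vanishes-at-λ {q = inj₂ c} _ _ q≢fx = classEntry-otherClass (q≢fx ∘ cong inj₂ ∘ sym)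

    vanishes-elsewhere : ∀ {x q} → ¬ x ∈ λ' → ¬ x ∈ up¹ → q ∈ indices → entry (vector q) x ≈ 0#
    vanishes-elsewhere {x} {inj₁ y} _ x∉up¹ q∈ =
      unitAt-offDiagonal {y} {x} λ { refl → x∉up¹ (inj₁∈indices⁻ q∈) }
    vanishes-elsewhere {q = inj₂ c} x∉λ _ _ = classEntry-outside x∉λ

    Z-independent : LinIndep F (map vector indices)
    Z-independent = biorthogonal⇒independent _≟Index_ vector pivot indices! diagonal offDiagonal
      where
      diagonal : ∀ {p} → p ∈ indices → entry (vector p) (pivot p) ≈ 1#
      diagonal {inj₁ x} _ = unitAt-diagonal x
      diagonal {inj₂ c} _ = classEntry-inClass (classEnd-∈ c) (f-classEnd c) (done (classEnd-terminal c))
      offDiagonal : ∀ {p q} → p ∈ indices → q ∈ indices → q ≢ p → entry (vector q) (pivot p) ≈ 0#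
      offDiagonal {inj₁ x} p∈ q∈ q≢p = vanishes-at-↑¹ (inj₁∈indices⁻ p∈) q∈ q≢p
      offDiagonal {inj₂ c} _ q∈ q≢p =
        vanishes-at-λ (classEnd-∈ c) q∈ λ q≡ → q≢p (trans q≡ (cong inj₂ (f-classEnd c)))

    Z-spans : Spans F (Zsp F n λ' ν σ) (map vector indices)
    Z-spans a a∈Z =
      map coefficient indices , trans (length-map _ indices) (sym (length-map _ indices)) ,
      λ r s → expansion (r , s)
      where
      coefficient : Index → Carrier
      coefficient (inj₁ x) = entry a x
      coefficient (inj₂ c) = entry a (classEnd c)
      expansion : ∀ x → entry a x ≈ entry (combination coefficient vector indices) x
      expansion x with x ∈? up¹ | x ∈? λ'
      ... | yes x∈up¹ | _ = begin
        entry a x                                         ≈⟨ *-identityʳ _ ⟨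
        entry a x *F 1#                                   ≈⟨ *-cong ≈-refl (unitAt-diagonal x) ⟨
        entry a x *F entry (unitAt x) x
          ≈⟨ combination-single _ _ indices! x∈indices others≈0 ⟨
        entry (combination coefficient vector indices) x  ∎
        where
        x∈indices : inj₁ x ∈ indices
        x∈indices = ∈-++⁺ˡ (∈-map⁺ inj₁ x∈up¹)
        others≈0 : ∀ {q} → q ∈ indices → q ≢ inj₁ x → coefficient q *F entry (vector q) x ≈ 0#
        others≈0 q∈ q≢x = *-vanishʳ (vanishes-at-↑¹ x∈up¹ q∈ q≢x)
      ... | no _ | yes x∈λ = begin
        entry a x
          ≈⟨ Z-along-↝ a∈Z ρ ⟩
        weight ρ *F entry a (classEnd (fc x))
          ≈⟨ *-comm _ _ ⟩
        entry a (classEnd (fc x)) *F weight ρ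
          ≈⟨ *-cong ≈-refl (classEntry-inClass x∈λ refl ρ) ⟨
        entry a (classEnd (fc x)) *F classEntry (fc x) x
          ≈⟨ combination-single _ _ indices! class∈indices others≈0 ⟨
        entry (combination coefficient vector indices) x  ∎
        where
        ρ : x ↝ classEnd (fc x)
        ρ = ↝-classEnd x∈λ
        class∈indices : inj₂ (fc x) ∈ indices
        class∈indices = ∈-++⁺ʳ (map inj₁ up¹) (∈-map⁺ inj₂ (∈-allFin (fc x)))
        others≈0 : ∀ {q} → q ∈ indices → q ≢ inj₂ (fc x) → coefficient q *F entry (vector q) x ≈ 0#
        others≈0 q∈ q≢x = *-vanishʳ (vanishes-at-λ x∈λ q∈ q≢x)
      ... | no x∉up¹ | no x∉λ =
        ≈-trans (proj₁ a∈Z _ _ λ x∈↑ → x∉up¹ (up¹⁺ (↑-λ⊆↑¹ x∈↑ x∉λ)))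
                (≈-sym (combination-vanishing _ _ indices λ q∈ →
                          *-vanishʳ (vanishes-elsewhere x∉λ x∉up¹ q∈)))

    Zsp-dim : IsDim F (Zsp F n λ' ν σ) (length up¹ + kc)
    Zsp-dim = map vector indices , trans (length-map vector indices) length-indices ,
              All.map⁺ (All.tabulate vector-Z) , Z-independent , Z-spans
      where
      vector-Z : ∀ {q} → q ∈ indices → Zsp F n λ' ν σ (vector q)
      vector-Z {inj₁ x} q∈ = unitAt-Z (inj₁∈indices⁻ q∈)
      vector-Z {inj₂ c} _ = classVector-Z c

  module DspBasis {kr : ℕ} (rows : NumClasses ν Row kr) where

    open Rows
    open Classes (proj₁ rows) (proj₁ (proj₂ rows)) (proj₂ (proj₂ rows))

    rowWeight : Arc → Arc → Carrier
    rowWeight (i , k) (j , l) = σ i j k l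

    rowVector : Arc → Mat F
    rowVector p with successor? p
    ... | yes (y , _) = _+M_ F (unitAt p) (_·M_ F (- rowWeight p y) (unitAt y))
    ... | no _        = unitAt p

    rowVector-diagonal : ∀ p → entry (rowVector p) p ≈ 1#
    rowVector-diagonal p with successor? p
    ... | no _ = unitAt-diagonal p
    ... | yes (y , row) = begin
      entry (unitAt p) p +F (- rowWeight p y) *F entry (unitAt y) p
        ≈⟨ +-cong (unitAt-diagonal p) (*-vanishʳ (unitAt-offDiagonal {y} {p} p≢y)) ⟩
      1# +F 0#
        ≈⟨ +-identityʳ 1# ⟩
      1# ∎
      where
      p≢y : p ≢ y
      p≢y refl = <-irrefl refl (Row-ascending row)

    rowVector-offDiagonal : ∀ {p x} → x ≢ p → ¬ Row p x → entry (rowVector p) x ≈ 0#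
    rowVector-offDiagonal {p} {x} x≢p ¬row with successor? p
    ... | no _ = unitAt-offDiagonal x≢p
    ... | yes (y , row) =
      ≈-trans (+-cong (unitAt-offDiagonal x≢p) (*-vanishʳ (unitAt-offDiagonal {y} {x} x≢y)))
              (+-identityˡ 0#)
      where
      x≢y : x ≢ y
      x≢y refl = ¬row row

    rowVector-terminal : ∀ {p} → Terminal p → rowVector p ≋ unitAt p
    rowVector-terminal {p} terminal with successor? p
    ... | yes successor = contradiction successor terminal
    ... | no _          = λ r s → ≈-refl

    rowVector-generator : ∀ {i j l} → IsBinding λ' ν i j (suc j) l → ∀ c →
      gen F σ (i , j , l , c) ≋ _·M_ F c (rowVector (i , suc j))
    rowVector-generator {i} {j} {l} b c with successor? (i , suc j)
    ... | no terminal = contradiction (_ , i , j , suc j , l , b , refl , refl) terminal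
    ... | yes (y , row) with Row-functional (i , j , suc j , l , b , refl , refl) row
    ...   | refl = λ r s → ≈-refl

    IsEnd : Arc → Set
    IsEnd p = p ∈ ν × Terminal p

    isEnd? : ∀ p → Dec (IsEnd p)
    isEnd? p = (p ∈? ν) ×-dec ¬? (successor? p)

    ends nonEnds : List Arc
    ends = filter isEnd? up¹
    nonEnds = filter (¬? ∘ isEnd?) up¹

    nonEnds⁺ : ∀ {p} → p ∈ up¹ → ¬ IsEnd p → p ∈ nonEnds
    nonEnds⁺ = ∈-filter⁺ (¬? ∘ isEnd?)

    nonEnds⁻ : ∀ {p} → p ∈ nonEnds → p ∈ up¹ × ¬ IsEnd p
    nonEnds⁻ = ∈-filter⁻ (¬? ∘ isEnd?) {xs = up¹}

    ends-count : length ends ≡ kr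
    ends-count = terminals-count (Unique.filter⁺ isEnd? up¹!) (mk⇔ ∈ends⇒end end⇒∈ends)
      where
      ∈ends⇒end : ∀ {x} → x ∈ ends → IsEnd x
      ∈ends⇒end = proj₂ ∘ ∈-filter⁻ isEnd? {xs = up¹}
      end⇒∈ends : ∀ {x} → IsEnd x → x ∈ ends
      end⇒∈ends end@(x∈ν , _) = ∈-filter⁺ isEnd? (up¹⁺ (ν⊆↑¹ x∈ν)) end

    rowVector-D : ∀ {p} → p ∈ nonEnds → Dsp F n λ' ν σ (rowVector p)
    rowVector-D {p} p∈ with successor? p
    ... | yes (_ , i , j , k , l , b , refl , refl) with binding-adjacent b
    ...   | refl = 0M F , (i , j , l , 1#) ∷ [] , (λ _ _ _ → ≈-refl) , b ∷ [] ,
                   λ r s → ≈-sym (≈-trans (+-identityˡ _) (≈-trans (+-identityʳ _) (*-identityˡ _)))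
    rowVector-D {p} p∈ | no terminal with nonEnds⁻ p∈
    ... | p∈up¹ , ¬end = unitAt p , [] , outside , [] , λ r s → ≈-sym (+-identityʳ _)
      where
      p∉S : ¬ p ∈ λ' ++ ν
      p∉S p∈S = [ up¹-disjoint-λ p∈up¹ , (λ p∈ν → ¬end (p∈ν , terminal)) ]′ (∈-++⁻ λ' p∈S)
      outside : ∀ r s → ¬ (Up 0 n λ' (r , s) × ¬ (r , s) ∈ λ' ++ ν) → entry (unitAt p) (r , s) ≈ 0#
      outside r s ¬free = unitAt-offDiagonal {p} {r , s} λ { refl → ¬free (↑¹⊆↑ (up¹⁻ p∈up¹) , p∉S) }

    D-independent : LinIndep F (map rowVector nonEnds)
    D-independent = unitriangular⇒independent _≟Arc_ rowVector (λ p → p) proj₁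
      (Unique.filter⁺ (¬? ∘ isEnd?) up¹!) (λ {p} _ → rowVector-diagonal p) lower
      where
      lower : ∀ {p q} → p ∈ nonEnds → q ∈ nonEnds → q ≢ p →
        entry (rowVector q) p ≈ 0# ⊎ proj₁ q < proj₁ p
      lower {p} {q} _ _ q≢p with Row? q p
      ... | yes row = inj₂ (Row-ascending row)
      ... | no ¬row = inj₁ (rowVector-offDiagonal (q≢p ∘ sym) ¬row)

    D-spans : Spans F (Dsp F n λ' ν σ) (map rowVector nonEnds)
    D-spans a (b , L , b-free , L-bindings , a≋) =
      span-resp-≋ a≋ (span-+ b∈ (generators∈ L L-bindings))
      where
      B : List (Mat F)
      B = map rowVector nonEnds

      nonEnd∈ : ∀ {p} → p ∈ up¹ → ¬ IsEnd p → InSpan B (rowVector p)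
      nonEnd∈ p∈up¹ ¬end = span-∈ (∈-map⁺ rowVector (nonEnds⁺ p∈up¹ ¬end))

      generators∈ : ∀ L → All (λ { (i , j , l , c) → IsBinding λ' ν i j (suc j) l }) L →
        InSpan B (sumGen F σ L)
      generators∈ [] [] = span-0
      generators∈ ((i , j , l , c) ∷ L) (bind@(_ , _ , ik , _) ∷ L-bindings) =
        span-+ (span-resp-≋ (rowVector-generator bind c) (span-· c (nonEnd∈ (up¹⁺ (ν⊆↑¹ ik)) ¬end)))
               (generators∈ L L-bindings)
        where
        ¬end : ¬ IsEnd (i , suc j)
        ¬end (_ , terminal) = terminal (_ , i , j , suc j , l , bind , refl , refl)

      ∉ν? : ∀ p → Dec (¬ p ∈ ν)
      ∉ν? p = ¬? (p ∈? ν)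

      free : List Arc
      free = filter ∉ν? up¹

      b-supported : ∀ {x} → ¬ x ∈ free → entry b x ≈ 0#
      b-supported x∉free = b-free _ _ λ (x∈↑ , x∉S) →
        x∉free (∈-filter⁺ ∉ν? (up¹⁺ (↑-λ⊆↑¹ x∈↑ (x∉S ∘ ∈-++⁺ˡ))) (x∉S ∘ ∈-++⁺ʳ λ'))

      free-unit∈ : ∀ {v} → v ∈ map unitAt free → InSpan B v
      free-unit∈ v∈ with ∈-map⁻ unitAt v∈
      ... | p , p∈free , refl with ∈-filter⁻ ∉ν? {xs = up¹} p∈free
      ...   | p∈up¹ , p∉ν =
        span-resp-≋ (λ r s → ≈-sym (rowVector-terminal terminal r s)) (nonEnd∈ p∈up¹ (p∉ν ∘ proj₁))
        where
        terminal : Terminal p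
        terminal (_ , row) = p∉ν (Row-source row)

      b∈ : InSpan B b
      b∈ = span-resp-≋ (expand-supported (Unique.filter⁺ _ up¹!) b-supported)
                       (span-lincomb (map unitAt free) free-unit∈ (map (entry b) free))

    Dsp-dim : kr ≤ length up¹ × IsDim F (Dsp F n λ' ν σ) (length up¹ ∸ kr)
    Dsp-dim = subst (_≤ length up¹) ends-count (subst (length ends ≤_) partition (m≤m+n _ _)) ,
              (map rowVector nonEnds , trans (length-map rowVector nonEnds) length-nonEnds ,
               All.map⁺ (All.tabulate rowVector-D) , D-independent , D-spans)
      where
      partition : length ends + length nonEnds ≡ length up¹
      partition = length-filter-∁ isEnd? up¹
      length-nonEnds : length nonEnds ≡ length up¹ ∸ kr
      length-nonEnds =
        trans (sym (m+n∸m≡n (length ends) (length nonEnds))) (cong₂ _∸_ partition ends-count)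

corollary4p13 : (F : CommutativeRing 0ℓ 0ℓ) → IsField F → (q : ℕ) → HasOrder F q →
    (n : ℕ) → (λ' ν : List Arc) → IsSetPartition n λ' → Nonnesting λ' →
    IsSplice n λ' ν → Tight n λ' ν →
    (σ : Weight F) → IsUnitWeight F λ' ν σ →
    (N kr kc : ℕ) → HasCard (Up 1 n λ') N →
    NumClasses ν (RowGen λ' ν) kr → NumClasses λ' (ColGen λ' ν) kc →
    (kr ≤ N × IsDim F (Dsp F n λ' ν σ) (N ∸ kr)) × IsDim F (Zsp F n λ' ν σ) (N + kc)
corollary4p13 F _ _ _ n λ' ν _ nonnesting splice tight σ _ _ kr kc (up¹ , up¹! , ∈up¹ , refl) rows cols =
  DspBasis.Dsp-dim rows , ZspBasis.Zsp-dim cols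
  where open Dimensions F splice nonnesting tight σ up¹! ∈up¹
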